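{- Let $d\geq2$ and $0\leq N<d!$ be integers. Then $$\mathrm{des}(\aleph^{ -1}(N))=N-\sum_{i=0}^{d-2}\left\lfloor\frac{N}{i!\,(i+2)}\right\rfloor.$$
   Context: $\mathfrak{S}_d$ is the set of permutations $\pi=\pi_1\cdots\pi_d$ of $\{1,\ldots,d\}$; $\mathrm{des}(\pi)$ is the number of $j\in\{1,\ldots,d-1\}$ with $\pi_j>\pi_{j+1}$. The inversion table of $\pi$ is $(c_1,\ldots,c_d)$ with $c_i=\#\{j>i:\pi_i>\pi_j\}$ (so $0\leq c_i\leq d-i$). The map $\aleph:\mathfrak{S}_d\to\{0,1,\ldots,d!-1\}$, $\aleph(\pi)=\sum_{i=1}^dc_i\,(d-i)!$, is a bijection, and $\aleph^{ -1}$ denotes its inverse. -}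

module Defs where

open import Data.Nat using (ℕ; zero; suc; _+_; _*_; _∸_; _<_; _<?_; _!)
open import Data.Nat.DivMod using (_/_)
open import Data.Fin using (Fin; toℕ)
open import Data.Fin.Permutation using (Permutation′; _⟨$⟩ʳ_)
open import Data.List using (List; map; allFin; upTo)
open import Data.Nat.ListAction using (sum)
open import Relation.Nullary using (Dec; yes; no)

-- Permutations of {1,…,d} are modelled as permutations of Fin d = {0,…,d-1}
-- (positions and values shifted down by one; relative order is preserved).
Perm : ℕ → Set
Perm d = Permutation′ d

𝟙 : ∀ {p} {P : Set p} → Dec P → ℕ
𝟙 (yes _) = 1
𝟙 (no _)  = 0

ΣFin : (n : ℕ) → (Fin n → ℕ) → ℕ
ΣFin n f = sum (map f (allFin n))

-- des(π) = #{ j : π_j > π_{j+1} }  (0-indexed positions j, j+1 both in Fin d)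
des : ∀ {d} → Perm d → ℕ
des {d} π = ΣFin d λ j → ΣFin d λ k →
  𝟙 (suc (toℕ j) Data.Nat.≟ toℕ k) * 𝟙 (toℕ (π ⟨$⟩ʳ k) <? toℕ (π ⟨$⟩ʳ j))

invEntry : ∀ {d} → Perm d → Fin d → ℕ
invEntry {d} π i = ΣFin d λ j →
  𝟙 (toℕ i <? toℕ j) * 𝟙 (toℕ (π ⟨$⟩ʳ j) <? toℕ (π ⟨$⟩ʳ i))

-- ℵ(π) = Σ_i c_i (d - i)!  with 1-indexed i; for 0-indexed i this is (d - 1 - i)!
aleph : ∀ {d} → Perm d → ℕ
aleph {d} π = ΣFin d λ i → invEntry π i * ((d ∸ 1 ∸ toℕ i) !)

-- floor division (the divisor below is always nonzero)
fdiv : ℕ → ℕ → ℕ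
fdiv m zero    = 0
fdiv m (suc k) = m / suc k

floorSum : ℕ → ℕ → ℕ
floorSum d N = sum (map (λ i → fdiv N ((i !) * (i + 2))) (upTo (d ∸ 1)))

{-# OPTIONS --safe #-}
-- ℵ(π) = N is the factorial-base expansion N = Σ_m b_m m! with digits 0 ≤ b_m ≤ m, where
-- b_m = c_{d-1-m} is the inversion table read backwards. The quotients T_k = ⌊N/k!⌋ satisfy
-- T_k = b_k + (k+1) T_{k+1}, and ⌊N/(k!(k+2))⌋ = ⌊T_k/(k+2)⌋. Dividing by k+2 gives
--   ⌊T_k/(k+2)⌋ + [b_k < b_{k+1}] + T_{k+2} = T_{k+1},
-- since T_k ≡ b_k − b_{k+1} (mod k+2), and b_k − b_{k+1} lies in [0, k] if b_k ≥ b_{k+1}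
-- and in [−(k+1), −1] otherwise. Summing over k < d−1 telescopes to T_1 − T_d = N.
-- Finally π_j > π_{j+1} iff c_j > c_{j+1}, so des(π) is the number of ascents of b.
module Submission where

open import Defs
open import Data.Nat using (ℕ; zero; suc; _+_; _*_; _∸_; _≤_; _<_; _!; _<?_; _≟_; NonZero; z≤n; s≤s; s≤s⁻¹; z<s)
open import Data.Nat.Properties
open import Data.Nat.DivMod using (_/_; +-distrib-/-∣ʳ; m<n⇒m/n≡0; m*n/n≡m; m/n/o≡m/[n*o]; n/1≡n)
open import Data.Nat.Divisibility using (divides)
open import Data.Nat.ListAction using (sum)
open import Data.Nat.ListAction.Properties using (sum-++)
open import Data.Nat.Tactic.RingSolver using (solve-∀)
open import Algebra.Properties.CommutativeSemigroup +-commutativeSemigroup using (interchange)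
open import Data.Fin as Fin using (Fin; toℕ; fromℕ<)
open import Data.Fin.Properties using (toℕ<n; fromℕ<-toℕ)
open import Data.Fin.Permutation using (_⟨$⟩ʳ_)
open import Data.List using ([]; _∷_; _∷ʳ_; tabulate; applyUpTo)
open import Data.List.Properties using (applyUpTo-∷ʳ; map-tabulate; map-upTo)
open import Data.Product using (_×_; _,_)
open import Function using (_∘_; id)
open import Relation.Nullary using (Dec; yes; no; ¬_; contradiction)
open import Relation.Binary.PropositionalEquality
  using (_≡_; _≢_; refl; sym; trans; cong; cong₂; module ≡-Reasoning)

∑< : ℕ → (ℕ → ℕ) → ℕ
∑< n f = sum (applyUpTo f n)

syntax ∑< n (λ i → x) = ∑[ i < n ] x

∑-cong : ∀ n {f g : ℕ → ℕ} → (∀ i → i < n → f i ≡ g i) → ∑< n f ≡ ∑< n g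
∑-cong zero    f≗g = refl
∑-cong (suc n) f≗g = cong₂ _+_ (f≗g 0 z<s) (∑-cong n (λ i i<n → f≗g (suc i) (s≤s i<n)))

∑-init-last : ∀ n f → ∑< (suc n) f ≡ ∑< n f + f n
∑-init-last n f = begin
  sum (applyUpTo f (suc n))    ≡⟨ cong sum (applyUpTo-∷ʳ f n) ⟨
  sum (applyUpTo f n ∷ʳ f n)   ≡⟨ sum-++ (applyUpTo f n) (f n ∷ []) ⟩
  ∑< n f + (f n + 0)           ≡⟨ cong (∑< n f +_) (+-identityʳ (f n)) ⟩
  ∑< n f + f n                 ∎
  where open ≡-Reasoning

∑-distrib-+ : ∀ n f g → ∑[ i < n ] (f i + g i) ≡ ∑< n f + ∑< n g
∑-distrib-+ zero    f g = refl
∑-distrib-+ (suc n) f g =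
  trans (cong (f 0 + g 0 +_) (∑-distrib-+ n (f ∘ suc) (g ∘ suc))) (interchange (f 0) (g 0) _ _)

∑-mono-≤ : ∀ n {f g : ℕ → ℕ} → (∀ i → i < n → f i ≤ g i) → ∑< n f ≤ ∑< n g
∑-mono-≤ zero    f≤g = z≤n
∑-mono-≤ (suc n) f≤g = +-mono-≤ (f≤g 0 z<s) (∑-mono-≤ n (λ i i<n → f≤g (suc i) (s≤s i<n)))

∑-mono-< : ∀ n {f g : ℕ → ℕ} m → m < n →
           (∀ i → i < n → f i ≤ g i) → f m < g m → ∑< n f < ∑< n g
∑-mono-< (suc n) zero    _       f≤g fₘ<gₘ =
  +-mono-<-≤ fₘ<gₘ (∑-mono-≤ n (λ i i<n → f≤g (suc i) (s≤s i<n)))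
∑-mono-< (suc n) (suc m) (s≤s m<n) f≤g fₘ<gₘ =
  +-mono-≤-< (f≤g 0 z<s) (∑-mono-< n m m<n (λ i i<n → f≤g (suc i) (s≤s i<n)) fₘ<gₘ)

∑-zero : ∀ n {f : ℕ → ℕ} → (∀ i → i < n → f i ≡ 0) → ∑< n f ≡ 0
∑-zero zero    f≡0 = refl
∑-zero (suc n) f≡0 = cong₂ _+_ (f≡0 0 z<s) (∑-zero n (λ i i<n → f≡0 (suc i) (s≤s i<n)))

∑-single : ∀ n {f : ℕ → ℕ} m → m < n → (∀ i → i < n → i ≢ m → f i ≡ 0) → ∑< n f ≡ f m
∑-single (suc n) {f} zero _ f≡0 =
  trans (cong (f 0 +_) (∑-zero n (λ i i<n → f≡0 (suc i) (s≤s i<n) λ ())))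
        (+-identityʳ (f 0))
∑-single (suc n) (suc m) (s≤s m<n) f≡0 =
  cong₂ _+_ (f≡0 0 z<s λ ())
            (∑-single n m m<n (λ i i<n i≢m → f≡0 (suc i) (s≤s i<n) (i≢m ∘ suc-injective)))

∑-reverse : ∀ n f → ∑< n f ≡ ∑[ i < n ] f (n ∸ suc i)
∑-reverse zero    f = refl
∑-reverse (suc n) f = begin
  ∑< (suc n) f                    ≡⟨ ∑-init-last n f ⟩
  ∑< n f + f n                    ≡⟨ cong (_+ f n) (∑-reverse n f) ⟩
  ∑[ i < n ] f (n ∸ suc i) + f n  ≡⟨ +-comm _ (f n) ⟩
  f n + ∑[ i < n ] f (n ∸ suc i)  ∎
  where open ≡-Reasoning

∑-telescope : ∀ n {f g : ℕ → ℕ} → (∀ i → i < n → f i + g (suc i) ≡ g i) → ∑< n f + g n ≡ g 0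
∑-telescope zero    step = refl
∑-telescope (suc n) {f} {g} step = begin
  f 0 + ∑< n (f ∘ suc) + g (suc n)    ≡⟨ +-assoc (f 0) _ _ ⟩
  f 0 + (∑< n (f ∘ suc) + g (suc n))  ≡⟨ cong (f 0 +_) (∑-telescope n (λ i i<n → step (suc i) (s≤s i<n))) ⟩
  f 0 + g 1                           ≡⟨ step 0 z<s ⟩
  g 0                                 ∎
  where open ≡-Reasoning

tabulate≡applyUpTo : ∀ {A : Set} n {f : Fin n → A} {g : ℕ → A} → (∀ i → f i ≡ g (toℕ i)) →
                     tabulate f ≡ applyUpTo g n
tabulate≡applyUpTo zero    f≗g = refl
tabulate≡applyUpTo (suc n) f≗g =
  cong₂ _∷_ (f≗g Fin.zero) (tabulate≡applyUpTo n (f≗g ∘ Fin.suc))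

ΣFin≡∑ : ∀ n {f : Fin n → ℕ} (g : ℕ → ℕ) → (∀ i → f i ≡ g (toℕ i)) → ΣFin n f ≡ ∑< n g
ΣFin≡∑ n {f} g f≗g = cong sum (trans (map-tabulate id f) (tabulate≡applyUpTo n f≗g))

𝟙≡1 : ∀ {P : Set} (P? : Dec P) → P → 𝟙 P? ≡ 1
𝟙≡1 (yes _) _ = refl
𝟙≡1 (no ¬p) p = contradiction p ¬p

𝟙≡0 : ∀ {P : Set} (P? : Dec P) → ¬ P → 𝟙 P? ≡ 0
𝟙≡0 (yes p) ¬p = contradiction p ¬p
𝟙≡0 (no _)  _  = refl

𝟙*𝟙≤𝟙 : ∀ {P Q : Set} (P? : Dec P) (Q? : Dec Q) → 𝟙 P? * 𝟙 Q? ≤ 𝟙 P?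
𝟙*𝟙≤𝟙 (yes _) (yes _) = ≤-refl
𝟙*𝟙≤𝟙 (yes _) (no _)  = z≤n
𝟙*𝟙≤𝟙 (no _)  _       = z≤n

𝟙*𝟙-mono : ∀ {P Q P′ Q′ : Set} (P? : Dec P) (Q? : Dec Q) (P′? : Dec P′) (Q′? : Dec Q′) →
           (P → Q → P′ × Q′) → 𝟙 P? * 𝟙 Q? ≤ 𝟙 P′? * 𝟙 Q′?
𝟙*𝟙-mono (yes p) (yes q) P′? Q′? p∧q⇒p′∧q′ with p∧q⇒p′∧q′ p q
... | p′ , q′ = ≤-reflexive (sym (cong₂ _*_ (𝟙≡1 P′? p′) (𝟙≡1 Q′? q′)))
𝟙*𝟙-mono (yes _) (no _)  _ _ _ = z≤n
𝟙*𝟙-mono (no _)  _       _ _ _ = z≤n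

𝟙*𝟙-< : ∀ {P Q P′ Q′ : Set} (P? : Dec P) (Q? : Dec Q) (P′? : Dec P′) (Q′? : Dec Q′) →
        ¬ P → P′ → Q′ → 𝟙 P? * 𝟙 Q? < 𝟙 P′? * 𝟙 Q′?
𝟙*𝟙-< (yes p) _ _        _        ¬p _  _  = contradiction p ¬p
𝟙*𝟙-< (no _)  _ (yes _)  (yes _)  _  _  _  = z<s
𝟙*𝟙-< (no _)  _ (yes _)  (no ¬q′) _  _  q′ = contradiction q′ ¬q′
𝟙*𝟙-< (no _)  _ (no ¬p′) _        _  p′ _  = contradiction p′ ¬p′

∑𝟙[i<j] : ∀ n i → ∑[ j < n ] 𝟙 (i <? j) ≡ n ∸ suc i
∑𝟙[i<j] zero    i = refl
∑𝟙[i<j] (suc n) i = begin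
  ∑[ j < suc n ] 𝟙 (i <? j)           ≡⟨ ∑-init-last n _ ⟩
  ∑[ j < n ] 𝟙 (i <? j) + 𝟙 (i <? n)  ≡⟨ cong (_+ 𝟙 (i <? n)) (∑𝟙[i<j] n i) ⟩
  n ∸ suc i + 𝟙 (i <? n)              ≡⟨ add-last (i <? n) ⟩
  suc n ∸ suc i                       ∎
  where
  open ≡-Reasoning
  add-last : (i<?n : Dec (i < n)) → n ∸ suc i + 𝟙 i<?n ≡ suc n ∸ suc i
  add-last (yes i<n) = trans (+-comm _ 1) (sym (+-∸-assoc 1 i<n))
  add-last (no i≮n)  = trans (+-identityʳ _) (trans (m≤n⇒m∸n≡0 (m≤n⇒m≤1+n (≮⇒≥ i≮n)))
                                                    (sym (m≤n⇒m∸n≡0 (≮⇒≥ i≮n))))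

inversions : ℕ → (ℕ → ℕ) → ℕ → ℕ
inversions d p i = ∑[ j < d ] (𝟙 (i <? j) * 𝟙 (p j <? p i))

inversions≤ : ∀ d p i → inversions d p i ≤ d ∸ suc i
inversions≤ d p i = begin
  inversions d p i       ≤⟨ ∑-mono-≤ d (λ j _ → 𝟙*𝟙≤𝟙 (i <? j) (p j <? p i)) ⟩
  ∑[ j < d ] 𝟙 (i <? j)  ≡⟨ ∑𝟙[i<j] d i ⟩
  d ∸ suc i              ∎
  where open ≤-Reasoning

descent⇒inversions-descent : ∀ d p j → suc j < d → p (suc j) < p j →
                             inversions d p (suc j) < inversions d p j
descent⇒inversions-descent d p j 1+j<d pⱼ₊₁<pⱼ =
  ∑-mono-< d (suc j) 1+j<d pointwise
    (𝟙*𝟙-< (suc j <? suc j) (p (suc j) <? p (suc j)) (j <? suc j) (p (suc j) <? p j)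
           (n≮n (suc j)) (n<1+n j) pⱼ₊₁<pⱼ)
  where
  pointwise : ∀ k → k < d → 𝟙 (suc j <? k) * 𝟙 (p k <? p (suc j)) ≤ 𝟙 (j <? k) * 𝟙 (p k <? p j)
  pointwise k _ = 𝟙*𝟙-mono (suc j <? k) (p k <? p (suc j)) (j <? k) (p k <? p j)
    (λ j+1<k pₖ<pⱼ₊₁ → <-trans (n<1+n j) j+1<k , <-trans pₖ<pⱼ₊₁ pⱼ₊₁<pⱼ)

ascent⇒inversions-ascent : ∀ d p j → p j ≤ p (suc j) →
                           inversions d p j ≤ inversions d p (suc j)
ascent⇒inversions-ascent d p j pⱼ≤pⱼ₊₁ = ∑-mono-≤ d pointwise
  where
  pointwise : ∀ k → k < d → 𝟙 (j <? k) * 𝟙 (p k <? p j) ≤ 𝟙 (suc j <? k) * 𝟙 (p k <? p (suc j))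
  pointwise k _ = 𝟙*𝟙-mono (j <? k) (p k <? p j) (suc j <? k) (p k <? p (suc j))
    (λ j<k pₖ<pⱼ → ≤∧≢⇒< j<k (λ { refl → <⇒≱ pₖ<pⱼ pⱼ≤pⱼ₊₁ }) , <-≤-trans pₖ<pⱼ pⱼ≤pⱼ₊₁)

𝟙-descent≡𝟙-inversions-descent : ∀ d p j → suc j < d →
  𝟙 (p (suc j) <? p j) ≡ 𝟙 (inversions d p (suc j) <? inversions d p j)
𝟙-descent≡𝟙-inversions-descent d p j 1+j<d with p (suc j) <? p j
... | yes descent = sym (𝟙≡1 (_ <? _) (descent⇒inversions-descent d p j 1+j<d descent))
... | no ¬descent = sym (𝟙≡0 (_ <? _) (≤⇒≯ (ascent⇒inversions-ascent d p j (≮⇒≥ ¬descent))))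

[r+q*n]/n≡q : ∀ r q n .{{_ : NonZero n}} → r < n → (r + q * n) / n ≡ q
[r+q*n]/n≡q r q n r<n =
  trans (+-distrib-/-∣ʳ r (divides q refl)) (cong₂ _+_ (m<n⇒m/n≡0 r<n) (m*n/n≡m q n))

⌊_/_!⌋ : ℕ → ℕ → ℕ
⌊ m / k !⌋ = (m / k !) {{k !≢0}}

Factoradic : ℕ → (ℕ → ℕ) → Set
Factoradic n b = ∀ m → m < n → b m ≤ m

fromFactoradic : (ℕ → ℕ) → ℕ → ℕ
fromFactoradic b n = ∑[ m < n ] (b m * m !)

-- Σ_{m=k}^{k+n-1} b_m m!/k!, in Horner form
factoradicTail : (ℕ → ℕ) → ℕ → ℕ → ℕ
factoradicTail b zero    k = 0
factoradicTail b (suc n) k = b k + suc k * factoradicTail b n (suc k)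

ascents : ℕ → (ℕ → ℕ) → ℕ
ascents n b = ∑[ k < n ] 𝟙 (b k <? b (suc k))

fromFactoradic-split : ∀ b k n →
  fromFactoradic b (k + n) ≡ fromFactoradic b k + factoradicTail b n k * k !
fromFactoradic-split b k zero =
  trans (cong (fromFactoradic b) (+-identityʳ k)) (sym (+-identityʳ _))
fromFactoradic-split b k (suc n) = begin
  F (k + suc n)                        ≡⟨ cong F (+-suc k n) ⟩
  F (suc k + n)                        ≡⟨ fromFactoradic-split b (suc k) n ⟩
  F (suc k) + t * (suc k * k !)        ≡⟨ cong (_+ t * (suc k * k !)) (∑-init-last k _) ⟩
  F k + b k * k ! + t * (suc k * k !)  ≡⟨ horner (F k) (b k) t (suc k) (k !) ⟩
  F k + (b k + suc k * t) * k !        ∎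
  where
  open ≡-Reasoning
  F : ℕ → ℕ
  F = fromFactoradic b
  t : ℕ
  t = factoradicTail b n (suc k)
  horner : ∀ s c t m f → s + c * f + t * (m * f) ≡ s + (c + m * t) * f
  horner = solve-∀

fromFactoradic<! : ∀ {b} k → Factoradic k b → fromFactoradic b k < k !
fromFactoradic<! zero        _      = z<s
fromFactoradic<! {b} (suc k) digits = begin-strict
  fromFactoradic b (suc k)        ≡⟨ ∑-init-last k _ ⟩
  fromFactoradic b k + b k * k !  <⟨ +-mono-<-≤ (fromFactoradic<! k (λ m m<k → digits m (m<n⇒m<1+n m<k)))
                                                 (*-monoˡ-≤ (k !) (digits k (n<1+n k))) ⟩
  k ! + k * k !                   ≡⟨⟩
  suc k !                         ∎
  where open ≤-Reasoning

fromFactoradic/! : ∀ {b d} k n → k + n ≡ d → Factoradic d b →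
                   ⌊ fromFactoradic b d / k !⌋ ≡ factoradicTail b n k
fromFactoradic/! {b} k n refl digits = begin
  ⌊ fromFactoradic b (k + n) / k !⌋                         ≡⟨ cong ⌊_/ k !⌋ (fromFactoradic-split b k n) ⟩
  ⌊ fromFactoradic b k + factoradicTail b n k * k ! / k !⌋  ≡⟨ [r+q*n]/n≡q _ _ (k !) {{k !≢0}} F<k! ⟩
  factoradicTail b n k                                      ∎
  where
  open ≡-Reasoning
  F<k! : fromFactoradic b k < k !
  F<k! = fromFactoradic<! k (λ m m<k → digits m (<-≤-trans m<k (m≤m+n k n)))

fromFactoradic/!-step : ∀ {b d k} → Factoradic d b → k < d →
  ⌊ fromFactoradic b d / k !⌋ ≡ b k + suc k * ⌊ fromFactoradic b d / suc k !⌋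
fromFactoradic/!-step {b} {d} {k} digits k<d = begin
  ⌊ fromFactoradic b d / k !⌋
    ≡⟨ fromFactoradic/! k (suc j) (trans (+-suc k j) k+1+j≡d) digits ⟩
  b k + suc k * factoradicTail b j (suc k)
    ≡⟨ cong (λ t → b k + suc k * t) (fromFactoradic/! (suc k) j k+1+j≡d digits) ⟨
  b k + suc k * ⌊ fromFactoradic b d / suc k !⌋
    ∎
  where
  open ≡-Reasoning
  j : ℕ
  j = d ∸ suc k
  k+1+j≡d : suc k + j ≡ d
  k+1+j≡d = m+[n∸m]≡n k<d

quotient-no-ascent : ∀ k b₀ b₁ x → b₀ ≤ k → b₁ ≤ b₀ →
  (b₀ + suc k * (b₁ + suc (suc k) * x)) / suc (suc k) ≡ b₁ + suc k * x
quotient-no-ascent k b₀ b₁ x b₀≤k b₁≤b₀ with m≤n⇒∃[o]m+o≡n b₁≤b₀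
... | e , refl = begin
  (b₁ + e + suc k * (b₁ + suc (suc k) * x)) / suc (suc k)  ≡⟨ cong (_/ suc (suc k)) (regroup b₁ e k x) ⟩
  (e + (b₁ + suc k * x) * suc (suc k)) / suc (suc k)       ≡⟨ [r+q*n]/n≡q e _ (suc (suc k)) e<k+2 ⟩
  b₁ + suc k * x                                           ∎
  where
  open ≡-Reasoning
  e<k+2 : e < suc (suc k)
  e<k+2 = s≤s (≤-trans (m≤n+m e b₁) (m≤n⇒m≤1+n b₀≤k))
  regroup : ∀ b₁ e k x → b₁ + e + suc k * (b₁ + suc (suc k) * x) ≡ e + (b₁ + suc k * x) * suc (suc k)
  regroup = solve-∀

quotient-ascent : ∀ k b₀ b₁ x → b₀ < b₁ → b₁ ≤ suc k →
  (b₀ + suc k * (b₁ + suc (suc k) * x)) / suc (suc k) + 1 ≡ b₁ + suc k * x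
quotient-ascent k b₀ b₁ x b₀<b₁ b₁≤1+k with m≤n⇒∃[o]m+o≡n b₀<b₁
... | e , refl with m≤n⇒∃[o]m+o≡n (s≤s⁻¹ b₁≤1+k)
...   | f , refl = begin
  (b₀ + suc k * (suc b₀ + e + suc (suc k) * x)) / suc (suc k) + 1
    ≡⟨ cong (λ m → m / suc (suc k) + 1) (regroup b₀ e f x) ⟩
  (suc (b₀ + f) + (b₀ + e + suc k * x) * suc (suc k)) / suc (suc k) + 1
    ≡⟨ cong (_+ 1) ([r+q*n]/n≡q _ _ (suc (suc k)) b₀+f+1<k+2) ⟩
  b₀ + e + suc k * x + 1
    ≡⟨ +-comm _ 1 ⟩
  suc b₀ + e + suc k * x
    ∎
  where
  open ≡-Reasoning
  b₀+f+1<k+2 : suc (b₀ + f) < suc (suc k)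
  b₀+f+1<k+2 = s≤s (s≤s (+-monoˡ-≤ f (m≤m+n b₀ e)))
  regroup : ∀ b₀ e f x → let k = b₀ + e + f in
    b₀ + suc k * (suc b₀ + e + suc (suc k) * x) ≡ suc (b₀ + f) + (b₀ + e + suc k * x) * suc (suc k)
  regroup = solve-∀

quotient-plus-ascent : ∀ k b₀ b₁ x → b₀ ≤ k → b₁ ≤ suc k →
  (b₀ + suc k * (b₁ + suc (suc k) * x)) / suc (suc k) + 𝟙 (b₀ <? b₁) ≡ b₁ + suc k * x
quotient-plus-ascent k b₀ b₁ x b₀≤k b₁≤1+k with b₀ <? b₁
... | no b₀≮b₁  = trans (+-identityʳ _) (quotient-no-ascent k b₀ b₁ x b₀≤k (≮⇒≥ b₀≮b₁))
... | yes b₀<b₁ = quotient-ascent k b₀ b₁ x b₀<b₁ b₁≤1+k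

∑quotients+ascents≡fromFactoradic : ∀ {b} n → Factoradic (suc n) b →
  ∑[ k < n ] (⌊ fromFactoradic b (suc n) / k !⌋ / suc (suc k)) + ascents n b ≡ fromFactoradic b (suc n)
∑quotients+ascents≡fromFactoradic {b} n digits = begin
  ∑< n q + ascents n b                     ≡⟨ ∑-distrib-+ n q ascent ⟨
  ∑[ k < n ] (q k + ascent k)              ≡⟨ +-identityʳ _ ⟨
  ∑[ k < n ] (q k + ascent k) + 0          ≡⟨ cong (∑[ k < n ] (q k + ascent k) +_) T₁₊ₙ≡0 ⟨
  ∑[ k < n ] (q k + ascent k) + T (suc n)  ≡⟨ ∑-telescope n step ⟩
  T 1                                      ≡⟨ n/1≡n N ⟩
  N                                        ∎
  where
  open ≡-Reasoning
  N : ℕ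
  N = fromFactoradic b (suc n)
  T q ascent : ℕ → ℕ
  T k      = ⌊ N / k !⌋
  q k      = T k / suc (suc k)
  ascent k = 𝟙 (b k <? b (suc k))

  T₁₊ₙ≡0 : T (suc n) ≡ 0
  T₁₊ₙ≡0 = m<n⇒m/n≡0 {{suc n !≢0}} (fromFactoradic<! (suc n) digits)

  T-step : ∀ k → k < suc n → T k ≡ b k + suc k * T (suc k)
  T-step k = fromFactoradic/!-step digits

  step : ∀ k → k < n → q k + ascent k + T (suc (suc k)) ≡ T (suc k)
  step k k<n = begin
    T k / suc (suc k) + ascent k + x
      ≡⟨ cong (λ t → t / suc (suc k) + ascent k + x) Tₖ-in-digits ⟩
    (b k + suc k * (b (suc k) + suc (suc k) * x)) / suc (suc k) + ascent k + x
      ≡⟨ cong (_+ x) (quotient-plus-ascent k (b k) (b (suc k)) x (digits k k<1+n) (digits (suc k) (s≤s k<n))) ⟩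
    b (suc k) + suc k * x + x
      ≡⟨ collect (b (suc k)) k x ⟩
    b (suc k) + suc (suc k) * x
      ≡⟨ T-step (suc k) (s≤s k<n) ⟨
    T (suc k)
      ∎
    where
    x : ℕ
    x = T (suc (suc k))
    k<1+n : k < suc n
    k<1+n = m<n⇒m<1+n k<n
    Tₖ-in-digits : T k ≡ b k + suc k * (b (suc k) + suc (suc k) * x)
    Tₖ-in-digits = trans (T-step k k<1+n) (cong (λ t → b k + suc k * t) (T-step (suc k) (s≤s k<n)))
    collect : ∀ c k x → c + suc k * x + x ≡ c + suc (suc k) * x
    collect = solve-∀

fdiv≡/ : ∀ m n .{{_ : NonZero n}} → fdiv m n ≡ m / n
fdiv≡/ m (suc n) = refl

floorSum≡∑ : ∀ d N → floorSum d N ≡ ∑[ k < d ∸ 1 ] (⌊ N / k !⌋ / suc (suc k))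
floorSum≡∑ d N = trans (cong sum (map-upTo _ (d ∸ 1))) (∑-cong (d ∸ 1) (λ k _ → fdiv≡⌊/!⌋/ k))
  where
  fdiv≡⌊/!⌋/ : ∀ k → fdiv N (k ! * (k + 2)) ≡ ⌊ N / k !⌋ / suc (suc k)
  fdiv≡⌊/!⌋/ k = begin
    fdiv N (k ! * (k + 2))      ≡⟨ cong (λ m → fdiv N (k ! * m)) (+-comm k 2) ⟩
    fdiv N (k ! * suc (suc k))  ≡⟨ fdiv≡/ N (k ! * suc (suc k)) ⟩
    N / (k ! * suc (suc k))     ≡⟨ m/n/o≡m/[n*o] N (k !) (suc (suc k)) {{k !≢0}} ⟨
    ⌊ N / k !⌋ / suc (suc k)    ∎
    where
    open ≡-Reasoning
    instance
      k!*[k+2]≢0 : NonZero (k ! * suc (suc k))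
      k!*[k+2]≢0 = m*n≢0 (k !) (suc (suc k)) {{k !≢0}}

-- π applied to k : ℕ, with the junk value 0 when k ≥ d
_⟨$⟩ℕ_ : ∀ {d} → Perm d → ℕ → ℕ
_⟨$⟩ℕ_ {d} π k with k <? d
... | yes k<d = toℕ (π ⟨$⟩ʳ fromℕ< k<d)
... | no _    = 0

⟨$⟩ℕ-toℕ : ∀ {d} (π : Perm d) i → π ⟨$⟩ℕ toℕ i ≡ toℕ (π ⟨$⟩ʳ i)
⟨$⟩ℕ-toℕ {d} π i with toℕ i <? d
... | yes i<d = cong (λ j → toℕ (π ⟨$⟩ʳ j)) (fromℕ<-toℕ i i<d)
... | no i≮d  = contradiction (toℕ<n i) i≮d

𝟙<-⟨$⟩ℕ-toℕ : ∀ {d} (π : Perm d) i j →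
  𝟙 (toℕ (π ⟨$⟩ʳ i) <? toℕ (π ⟨$⟩ʳ j)) ≡ 𝟙 (π ⟨$⟩ℕ toℕ i <? π ⟨$⟩ℕ toℕ j)
𝟙<-⟨$⟩ℕ-toℕ π i j = cong₂ (λ x y → 𝟙 (x <? y)) (sym (⟨$⟩ℕ-toℕ π i)) (sym (⟨$⟩ℕ-toℕ π j))

alephDigit : ∀ {n} → Perm (suc n) → ℕ → ℕ
alephDigit {n} π m = inversions (suc n) (π ⟨$⟩ℕ_) (n ∸ m)

alephDigit-factoradic : ∀ {n} (π : Perm (suc n)) → Factoradic (suc n) (alephDigit π)
alephDigit-factoradic {n} π m m<1+n =
  ≤-trans (inversions≤ (suc n) (π ⟨$⟩ℕ_) (n ∸ m)) (≤-reflexive (m∸[m∸n]≡n (s≤s⁻¹ m<1+n)))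

aleph≡fromFactoradic : ∀ {n} (π : Perm (suc n)) → aleph π ≡ fromFactoradic (alephDigit π) (suc n)
aleph≡fromFactoradic {n} π = begin
  aleph π
    ≡⟨ ΣFin≡∑ (suc n) (λ i → c i * (n ∸ i) !) (λ i → cong (_* (n ∸ toℕ i) !) (invEntry≡c i)) ⟩
  ∑[ i < suc n ] (c i * (n ∸ i) !)
    ≡⟨ ∑-reverse (suc n) (λ i → c i * (n ∸ i) !) ⟩
  ∑[ m < suc n ] (c (n ∸ m) * (n ∸ (n ∸ m)) !)
    ≡⟨ ∑-cong (suc n) (λ m m<1+n → cong (λ i → c (n ∸ m) * i !) (m∸[m∸n]≡n (s≤s⁻¹ m<1+n))) ⟩
  fromFactoradic (alephDigit π) (suc n)
    ∎
  where
  open ≡-Reasoning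
  c : ℕ → ℕ
  c = inversions (suc n) (π ⟨$⟩ℕ_)
  invEntry≡c : ∀ i → invEntry π i ≡ c (toℕ i)
  invEntry≡c i = ΣFin≡∑ (suc n) (λ j → 𝟙 (toℕ i <? j) * 𝟙 (π ⟨$⟩ℕ j <? π ⟨$⟩ℕ toℕ i))
    (λ j → cong (𝟙 (toℕ i <? toℕ j) *_) (𝟙<-⟨$⟩ℕ-toℕ π j i))

des≡∑descents : ∀ {n} (π : Perm (suc n)) → des π ≡ ∑[ j < n ] 𝟙 (π ⟨$⟩ℕ suc j <? π ⟨$⟩ℕ j)
des≡∑descents {n} π = begin
  des π                 ≡⟨ ΣFin≡∑ (suc n) row (λ j → ΣFin≡∑ (suc n) (entry (toℕ j)) (entry≡ j)) ⟩
  ∑< (suc n) row        ≡⟨ ∑-init-last n row ⟩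
  ∑< n row + row n      ≡⟨ cong₂ _+_ (∑-cong n (λ j j<n → row≡descent j (s≤s j<n))) last-row≡0 ⟩
  ∑< n descent + 0      ≡⟨ +-identityʳ _ ⟩
  ∑< n descent          ∎
  where
  open ≡-Reasoning
  p : ℕ → ℕ
  p = π ⟨$⟩ℕ_
  entry : ℕ → ℕ → ℕ
  entry j k = 𝟙 (suc j ≟ k) * 𝟙 (p k <? p j)
  entry≡ : ∀ j k →
    𝟙 (suc (toℕ j) ≟ toℕ k) * 𝟙 (toℕ (π ⟨$⟩ʳ k) <? toℕ (π ⟨$⟩ʳ j)) ≡ entry (toℕ j) (toℕ k)
  entry≡ j k = cong (𝟙 (suc (toℕ j) ≟ toℕ k) *_) (𝟙<-⟨$⟩ℕ-toℕ π k j)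
  row descent : ℕ → ℕ
  row j     = ∑[ k < suc n ] entry j k
  descent j = 𝟙 (p (suc j) <? p j)
  off-diagonal : ∀ j k → k ≢ suc j → entry j k ≡ 0
  off-diagonal j k k≢1+j = cong (_* 𝟙 (p k <? p j)) (𝟙≡0 (suc j ≟ k) (k≢1+j ∘ sym))
  row≡descent : ∀ j → suc j < suc n → row j ≡ descent j
  row≡descent j 1+j<1+n = begin
    row j                ≡⟨ ∑-single (suc n) (suc j) 1+j<1+n (λ k _ → off-diagonal j k) ⟩
    entry j (suc j)      ≡⟨ cong (_* descent j) (𝟙≡1 (suc j ≟ suc j) refl) ⟩
    1 * descent j        ≡⟨ *-identityˡ _ ⟩
    descent j            ∎
  last-row≡0 : row n ≡ 0
  last-row≡0 = ∑-zero (suc n) (λ k k<1+n → off-diagonal n k (λ { refl → n≮n _ k<1+n }))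

des≡ascents : ∀ {n} (π : Perm (suc n)) → des π ≡ ascents n (alephDigit π)
des≡ascents {n} π = begin
  des π
    ≡⟨ des≡∑descents π ⟩
  ∑[ j < n ] 𝟙 (p (suc j) <? p j)
    ≡⟨ ∑-cong n (λ j j<n → 𝟙-descent≡𝟙-inversions-descent (suc n) p j (s≤s j<n)) ⟩
  ∑[ j < n ] 𝟙 (c (suc j) <? c j)
    ≡⟨ ∑-reverse n (λ j → 𝟙 (c (suc j) <? c j)) ⟩
  ∑[ k < n ] 𝟙 (c (suc (n ∸ suc k)) <? c (n ∸ suc k))
    ≡⟨ ∑-cong n (λ k k<n → cong (λ i → 𝟙 (c i <? c (n ∸ suc k))) (sym (+-∸-assoc 1 k<n))) ⟩
  ascents n (alephDigit π)
    ∎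
  where
  open ≡-Reasoning
  p c : ℕ → ℕ
  p = π ⟨$⟩ℕ_
  c = inversions (suc n) p

theorem6p4 : (d : ℕ) → 2 ≤ d → (N : ℕ) → N < d ! →
    (π : Perm d) → aleph π ≡ N →
    des π + floorSum d N ≡ N
theorem6p4 (suc n) _ .(aleph π) _ π refl = begin
  des π + floorSum (suc n) (aleph π)  ≡⟨ cong (λ N → des π + floorSum (suc n) N) ℵ≡M ⟩
  des π + floorSum (suc n) M          ≡⟨ cong₂ _+_ (des≡ascents π) (floorSum≡∑ (suc n) M) ⟩
  ascents n b + ∑< n quotient         ≡⟨ +-comm (ascents n b) _ ⟩
  ∑< n quotient + ascents n b         ≡⟨ ∑quotients+ascents≡fromFactoradic n (alephDigit-factoradic π) ⟩
  M                                   ≡⟨ ℵ≡M ⟨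
  aleph π                             ∎
  where
  open ≡-Reasoning
  b : ℕ → ℕ
  b = alephDigit π
  M : ℕ
  M = fromFactoradic b (suc n)
  quotient : ℕ → ℕ
  quotient k = ⌊ M / k !⌋ / suc (suc k)
  ℵ≡M : aleph π ≡ M
  ℵ≡M = aleph≡fromFactoradic π
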